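{- Let $H$ be a br-graph and let $S$ be any subset of the properties {idempotence, conservativity, semi-conservativity, 3-NU, WNU}. Then $\mathcal{P}_H$ has a polymorphism satisfying all properties in $S$ if and only if the bipartite br-graph $\mathcal{P}_H\times P$ has a parity symmetric polymorphism satisfying all properties in $S$.
   Context: A br-graph is a pair of graphs (red edges, blue edges, loops allowed) on a common vertex set. The switching graph $\mathcal{P}_H$ has vertex set $V(H)\times\{1,2\}$; each red edge $uv$ of $H$ gives red edges $(u,1)(v,1)$, $(u,2)(v,2)$ and blue edges $(u,1)(v,2)$, $(u,2)(v,1)$, and each blue edge gives blue edges $(u,1)(v,1)$, $(u,2)(v,2)$ and red edges $(u,1)(v,2)$, $(u,2)(v,1)$. $P$ is the irreflexive br-graph on $\{0,1\}$ whose single edge $01$ is both red and blue; for a br-graph $K$, $K\times P$ has vertex set $V(K)\times\{0,1\}$ with $(u,i)(v,j)$ red (resp. blue) iff $uv$ is red (resp. blue) in $K$ and $i\ne j$. Write vertices of $\mathcal{P}_H\times P$ as triples $(v,i,j)$, $v\in V(H)$, $i\in\{1,2\}$, $j\in\{0,1\}$; the switch map $s$ changes $i$ and the parity switch map $p$ changes $j$. A polymorphism of $\mathcal{P}_H\times P$ is parity symmetric if it commutes with $p$ coordinatewise. A polymorphism (of $\mathcal{P}_H$ or $\mathcal{P}_H\times P$) is semi-conservative if it preserves every vertex set closed under $s$ (i.e. $\phi(T^k)\subseteq T$ whenever $s(T)=T$). A $k$-ary polymorphism of a br-graph maps $k$-tuples of red (resp. blue) edges coordinatewise to a red (resp. blue)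 edge; idempotent, conservative, 3-NU ($\phi(x,x,y)=\phi(x,y,x)=\phi(y,x,x)=x$) and WNU (idempotent with $\phi(x,\dots,x,y)=\dots=\phi(y,x,\dots,x)$) as usual. -}

module Defs where

open import Level using (0ℓ)
open import Data.Nat using (ℕ; suc; _≤_; _≡ᵇ_)
open import Data.Fin using (Fin; _≟_)
open import Data.Bool using (Bool; true; false; T; not; if_then_else_; _xor_)
open import Data.Product using (Σ; ∃; _×_; _,_)
open import Relation.Nullary using (Dec; yes; no; ¬_)
open import Relation.Binary.PropositionalEquality using (_≡_)

record BrGraph : Set where
  field
    n        : ℕ
    red      : Fin n → Fin n → Bool
    blue     : Fin n → Fin n → Bool
    red-sym  : ∀ u v → red u v ≡ red v u
    blue-sym : ∀ u v → blue u v ≡ blue v u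

record Struct : Set₁ where
  field
    Carrier : Set
    Red     : Carrier → Carrier → Set
    Blue    : Carrier → Carrier → Set

open Struct public

IsPolymorphism : (G : Struct) (k : ℕ) → ((Fin k → Carrier G) → Carrier G) → Set
IsPolymorphism G k φ =
  (∀ (xs ys : Fin k → Carrier G) → (∀ i → Red G (xs i) (ys i)) → Red G (φ xs) (φ ys)) ×
  (∀ (xs ys : Fin k → Carrier G) → (∀ i → Blue G (xs i) (ys i)) → Blue G (φ xs) (φ ys))

oneOff : {A : Set} {k : ℕ} → A → A → Fin k → Fin k → A
oneOff x y i j with j ≟ i
... | yes _ = y
... | no  _ = x

module _ {A : Set} {k : ℕ} (φ : (Fin k → A) → A) where

  Idempotent : Set
  Idempotent = ∀ x → φ (λ _ → x) ≡ x

  Conservative : Set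
  Conservative = ∀ xs → ∃ λ i → φ xs ≡ xs i

  -- T is closed under s, i.e. s(T) = T, literally as sets
  SClosed : (A → A) → (A → Set) → Set
  SClosed s P = (∀ v → P v → P (s v)) × (∀ v → P v → ∃ λ u → P u × s u ≡ v)

  SemiConservative : (A → A) → Set₁
  SemiConservative s = ∀ (P : A → Set) → SClosed s P →
    ∀ (xs : Fin k → A) → (∀ i → P (xs i)) → P (φ xs)

  NU3 : Set
  NU3 = (k ≡ 3) × (∀ x y i → φ (oneOff x y i) ≡ x)

  WNU : Set
  WNU = (2 ≤ k) × Idempotent × (∀ x y i j → φ (oneOff x y i) ≡ φ (oneOff x y j))

data Property : Set where
  idempotence conservativity semiConservativity nu3 wnu : Property

Satisfies : {A : Set} {k : ℕ} → (A → A) → ((Fin k → A) → A) → Property → Set₁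
Satisfies s φ idempotence        = Level.Lift _ (Idempotent φ)
Satisfies s φ conservativity     = Level.Lift _ (Conservative φ)
Satisfies s φ semiConservativity = SemiConservative φ s
Satisfies s φ nu3                = Level.Lift _ (NU3 φ)
Satisfies s φ wnu                = Level.Lift _ (WNU φ)

PropertySet : Set
PropertySet = Property → Bool

SatisfiesAll : {A : Set} {k : ℕ} → (A → A) → ((Fin k → A) → A) → PropertySet → Set₁
SatisfiesAll s φ S = ∀ p → T (S p) → Satisfies s φ p

-- switching graph P_H, vertices (v , i) with i : Bool encoding {1,2}
module _ (H : BrGraph) where
  open BrGraph H

  PVert : Set
  PVert = Fin n × Bool

  PRed PBlue : PVert → PVert → Set
  PRed  (u , a) (v , b) = T (if a xor b then blue u v else red u v)
  PBlue (u , a) (v , b) = T (if a xor b then red u v else blue u v)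

  switchingGraph : Struct
  switchingGraph = record { Carrier = PVert ; Red = PRed ; Blue = PBlue }

  switch : PVert → PVert
  switch (v , i) = (v , not i)

  QVert : Set
  QVert = Fin n × Bool × Bool

  QRed QBlue : QVert → QVert → Set
  QRed  (u , a , c) (v , b , d) = PRed  (u , a) (v , b) × T (c xor d)
  QBlue (u , a , c) (v , b , d) = PBlue (u , a) (v , b) × T (c xor d)

  switchingTimesP : Struct
  switchingTimesP = record { Carrier = QVert ; Red = QRed ; Blue = QBlue }

  switchQ : QVert → QVert
  switchQ (v , i , j) = (v , not i , j)

  parity : QVert → QVert
  parity (v , i , j) = (v , i , not j)

  ParitySymmetric : {k : ℕ} → ((Fin k → QVert) → QVert) → Set
  ParitySymmetric φ = ∀ xs → φ (λ i → parity (xs i)) ≡ parity (φ xs)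

HasPolyPH : BrGraph → PropertySet → Set₁
HasPolyPH H S = Σ ℕ λ k → Σ ((Fin (suc k) → PVert H) → PVert H) λ φ →
  IsPolymorphism (switchingGraph H) (suc k) φ × SatisfiesAll (switch H) φ S

HasParitySymPolyPHxP : BrGraph → PropertySet → Set₁
HasParitySymPolyPHxP H S = Σ ℕ λ k → Σ ((Fin (suc k) → QVert H) → QVert H) λ φ →
  IsPolymorphism (switchingTimesP H) (suc k) φ × ParitySymmetric H φ ×
  SatisfiesAll (switchQ H) φ S

module Submission where

-- A polymorphism φ of 𝒫_H lifts to 𝒫_H × P: on a tuple whose parities all agree apply φ to the
-- underlying vertices and keep the common parity; on a tuple of mixed parities return a coordinate
-- carrying the majority parity among the first three coordinates. Adjacent tuples of 𝒫_H × P have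
-- complementary parity patterns, so both cases respect the edges and commute with the parity
-- switch, and on (x, …, x, y, x, …, x) with x and y of different parities the result is x.
-- Majorities need arity at least 3: a unary φ is padded, and a binary WNU φ, i.e. a commutative
-- idempotent x ∙ y, is replaced by the 4-ary WNU (x₀ ∙ x₁) ∙ (x₂ ∙ x₃). Conversely a parity
-- symmetric ψ restricts to the vertices of parity 0.
--
-- Without function extensionality an operation need not respect pointwise equality of tuples,
-- while the (W)NU laws speak only about the literal tuples oneOff x y i. Therefore operations are
-- only ever evaluated on a canonical presentation of their input, computed from its values and a
-- total order on the vertices of 𝒫_H.

open import Data.Bool as Bool using (Bool; true; false; T; not; _xor_; _∧_; if_then_else_)
open import Data.Bool.Properties using (not-involutive; ¬-not) renaming (_≟_ to _≟ᵇ_; <-cmp to <ᵇ-cmp)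
open import Data.Empty using (⊥-elim)
open import Data.Fin as Fin using (Fin; zero; suc)
open import Data.Fin.Properties using (all?; any?) renaming (_≟_ to _≟ᶠ_; <-cmp to <ᶠ-cmp)
open import Data.Nat using (ℕ; zero; suc; _+_; _≤_; s≤s; z≤n)
open import Data.Product using (Σ; ∃; ∃₂; _×_; _,_; proj₁; proj₂)
open import Data.Product.Relation.Binary.Lex.Strict using (×-Lex; ×-compare)
open import Data.Product.Relation.Binary.Pointwise.NonDependent using (Pointwise; ≡×≡⇒≡; ≡⇒≡×≡)
open import Data.Sum using (_⊎_; inj₁; inj₂)
open import Data.Unit using (tt)
open import Data.Vec using (Vec; []; _∷_; tabulate; lookup)
open import Data.Vec.Properties using (lookup∘tabulate; tabulate-cong)
open import Function using (_∘_; id)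
open import Function.Bundles using (_⇔_; mk⇔)
open import Level using (0ℓ; lift; lower)
open import Relation.Binary using (Rel; Trichotomous; tri<; tri≈; tri>; DecidableEquality)
open import Relation.Binary.Consequences using (tri⇒dec≈)
open import Relation.Binary.PropositionalEquality
open import Relation.Nullary using (Dec; yes; no; ¬_)
open import Relation.Nullary.Decidable using (_⊎-dec_)

open import Defs

module _ {A : Set} {k : ℕ} (x y : A) (i : Fin k) where

  oneOff-here : oneOff x y i i ≡ y
  oneOff-here with i ≟ᶠ i
  ... | yes _ = refl
  ... | no i≢i = ⊥-elim (i≢i refl)

  oneOff-there : ∀ {t} → t ≢ i → oneOff x y i t ≡ x
  oneOff-there {t} t≢i with t ≟ᶠ i
  ... | yes t≡i = ⊥-elim (t≢i t≡i)
  ... | no _ = refl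

oneOff-diag : ∀ {A : Set} {k} (x : A) (i t : Fin k) → oneOff x x i t ≡ x
oneOff-diag x i t with t ≟ᶠ i
... | yes _ = refl
... | no _ = refl

oneOff-map : ∀ {A B : Set} {k} (f : A → B) (x y : A) (i t : Fin k) →
             f (oneOff x y i t) ≡ oneOff (f x) (f y) i t
oneOff-map f x y i t with t ≟ᶠ i
... | yes _ = refl
... | no _ = refl

Preserves : ∀ {X : Set} {k} → ((Fin k → X) → X) → (X → X → Set) → Set
Preserves φ R = ∀ xs ys → (∀ i → R (xs i) (ys i)) → R (φ xs) (φ ys)

Extensional : ∀ {A B : Set} {k} → ((Fin k → A) → B) → Set
Extensional φ = ∀ {xs ys} → xs ≗ ys → φ xs ≡ φ ys

-- Without function extensionality φ (λ _ → y) and φ (oneOff y y zero) are unrelated: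
-- idempotence speaks about the first tuple, the 3-NU identities only about the second, so a
-- constant tuple is presented in the form covered by the available law.
diagonal : ∀ {B : Set} {k} → Bool → B → Fin (suc k) → B
diagonal false y _ = y
diagonal true  y   = oneOff y y zero

diagonal-≗ : ∀ {B : Set} {k} b (y : B) (t : Fin (suc k)) → diagonal b y t ≡ y
diagonal-≗ false y t = refl
diagonal-≗ true  y t = oneOff-diag y zero t

NUIdentities : ∀ {A : Set} {k} → ((Fin k → A) → A) → Set
NUIdentities φ = ∀ x y i → φ (oneOff x y i) ≡ x

WNUIdentities : ∀ {A B : Set} {k} → ((Fin k → A) → B) → Set
WNUIdentities φ = ∀ x y i j → φ (oneOff x y i) ≡ φ (oneOff x y j)

DiagonalFixed : ∀ {B : Set} {k} → Bool → ((Fin (suc k) → B) → B) → Set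
DiagonalFixed b φ = ∀ y → φ (diagonal b y) ≡ y

module Presentation {A : Set} {_<_ : Rel A 0ℓ} (compare : Trichotomous _≡_ _<_) where

  _≟_ : DecidableEquality A
  _≟_ = tri⇒dec≈ compare

  data Form (k : ℕ) : Set where
    constant : A → Form k
    single   : A → A → Fin k → Form k
    generic  : Vec A k → Form k

  ⟦_⟧ : ∀ {B : Set} {k} → Form (suc k) → Bool → (A → B) → Fin (suc k) → B
  ⟦ constant x ⟧   b f   = diagonal b (f x)
  ⟦ single x y i ⟧ b f   = oneOff (f x) (f y) i
  ⟦ generic v ⟧    b f t = f (lookup v t)

  -- A binary tuple (x , y) with x ≢ y is both oneOff x y 1 and oneOff y x 0; the order decides.
  pairForm : A → A → Form 2
  pairForm x y with compare x y
  ... | tri< _ _ _ = single x y (suc zero)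
  ... | tri≈ _ _ _ = constant x
  ... | tri> _ _ _ = single y x zero

  majority : A → A → A → A
  majority x y z with x ≟ y
  ... | yes _ = x
  ... | no _ with x ≟ z
  ...   | yes _ = x
  ...   | no _  = y

  AllBut : ∀ {k} → Vec A k → A → Fin k → Set
  AllBut v m i = ∀ t → t ≡ i ⊎ lookup v t ≡ m

  allBut? : ∀ {k} (v : Vec A k) m → Dec (∃ (AllBut v m))
  allBut? v m = any? (λ i → all? (λ t → (t ≟ᶠ i) ⊎-dec (lookup v t ≟ m)))

  formWithMajority : ∀ {k} → A → Vec A k → Form k
  formWithMajority m v with allBut? v m
  ... | no _ = generic v
  ... | yes (i , _) with lookup v i ≟ m
  ...   | yes _ = constant m
  ...   | no _  = single m (lookup v i) i

  form : ∀ {k} → Vec A (suc k) → Form (suc k)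
  form (x ∷ [])              = constant x
  form (x ∷ y ∷ [])          = pairForm x y
  form v@(x ∷ y ∷ z ∷ _)     = formWithMajority (majority x y z) v

  allBut-≢ : ∀ {k} {v : Vec A k} {m i t} → AllBut v m i → t ≢ i → lookup v t ≡ m
  allBut-≢ {t = t} around t≢i with around t
  ... | inj₁ t≡i = ⊥-elim (t≢i t≡i)
  ... | inj₂ vt≡m = vt≡m

  allBut-index : ∀ {k} {v : Vec A k} {m i j} → AllBut v m j → lookup v i ≢ m → i ≡ j
  allBut-index {i = i} around vi≢m with around i
  ... | inj₁ i≡j = i≡j
  ... | inj₂ vi≡m = ⊥-elim (vi≢m vi≡m)

  module _ {B : Set} (b : Bool) (f : A → B) where

    pairForm-sound : ∀ x y (t : Fin 2) → ⟦ pairForm x y ⟧ b f t ≡ f (lookup (x ∷ y ∷ []) t)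
    pairForm-sound x y t with compare x y
    pairForm-sound x y zero       | tri< _ _ _    = refl
    pairForm-sound x y (suc zero) | tri< _ _ _    = refl
    pairForm-sound x y zero       | tri≈ _ refl _ = diagonal-≗ b (f x) zero
    pairForm-sound x y (suc zero) | tri≈ _ refl _ = diagonal-≗ b (f x) (suc zero)
    pairForm-sound x y zero       | tri> _ _ _    = refl
    pairForm-sound x y (suc zero) | tri> _ _ _    = refl

    formWithMajority-sound : ∀ {k} m (v : Vec A (suc k)) t → ⟦ formWithMajority m v ⟧ b f t ≡ f (lookup v t)
    formWithMajority-sound m v t with allBut? v m
    ... | no _ = refl
    ... | yes (i , around) with lookup v i ≟ m
    ...   | yes vi≡m = trans (diagonal-≗ b (f m) t) (cong f (sym vt≡m))
      where
        vt≡m : lookup v t ≡ m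
        vt≡m with around t
        ... | inj₁ refl = vi≡m
        ... | inj₂ e    = e
    ...   | no _ with t ≟ᶠ i
    ...     | yes refl = refl
    ...     | no t≢i   = cong f (sym (allBut-≢ {v = v} around t≢i))

    form-sound : ∀ {k} (v : Vec A (suc k)) t → ⟦ form v ⟧ b f t ≡ f (lookup v t)
    form-sound (x ∷ [])          zero = diagonal-≗ b (f x) zero
    form-sound (x ∷ y ∷ [])      t    = pairForm-sound x y t
    form-sound v@(x ∷ y ∷ z ∷ _) t    = formWithMajority-sound (majority x y z) v t

  formWithMajority-constant : ∀ {k} {m} (v : Vec A (suc k)) → (∀ t → lookup v t ≡ m) →
                              formWithMajority m v ≡ constant m
  formWithMajority-constant {m = m} v all≡m with allBut? v m
  ... | no none = ⊥-elim (none (zero , λ t → inj₂ (all≡m t)))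
  ... | yes (i , _) with lookup v i ≟ m
  ...   | yes _    = refl
  ...   | no vi≢m  = ⊥-elim (vi≢m (all≡m i))

  formWithMajority-single : ∀ {k} {m} (v : Vec A k) i → (∀ t → t ≢ i → lookup v t ≡ m) → lookup v i ≢ m →
                            formWithMajority m v ≡ single m (lookup v i) i
  formWithMajority-single {m = m} v i rest vi≢m with allBut? v m
  ... | no none = ⊥-elim (none (i , around))
    where
      around : AllBut v m i
      around t with t ≟ᶠ i
      ... | yes t≡i = inj₁ t≡i
      ... | no t≢i  = inj₂ (rest t t≢i)
  ... | yes (j , around) with allBut-index {v = v} {i = i} around vi≢m
  ...   | refl with lookup v i ≟ m
  ...     | yes vi≡m = ⊥-elim (vi≢m vi≡m)
  ...     | no _     = refl

  majority-allBut : ∀ {k} (g : Fin (3 + k) → A) {m} i → (∀ t → t ≢ i → g t ≡ m) →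
                    majority (g zero) (g (suc zero)) (g (suc (suc zero))) ≡ m
  majority-allBut g i rest with g zero ≟ g (suc zero)
  majority-allBut g zero    rest | yes e = trans e (rest (suc zero) λ ())
  majority-allBut g (suc i) rest | yes _ = rest zero λ ()
  ... | no g₀≢g₁ with g zero ≟ g (suc (suc zero))
  majority-allBut g zero    rest | no _ | yes e = trans e (rest (suc (suc zero)) λ ())
  majority-allBut g (suc i) rest | no _ | yes _ = rest zero λ ()
  majority-allBut g zero                rest | no _     | no _     = rest (suc zero) λ ()
  majority-allBut g (suc zero)          rest | no _     | no g₀≢g₂ =
    ⊥-elim (g₀≢g₂ (trans (rest zero λ ()) (sym (rest (suc (suc zero)) λ ()))))
  majority-allBut g (suc (suc zero))    rest | no g₀≢g₁ | no _ =
    ⊥-elim (g₀≢g₁ (trans (rest zero λ ()) (sym (rest (suc zero) λ ()))))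
  majority-allBut g (suc (suc (suc i))) rest | no _     | no _ = rest (suc zero) λ ()

  form-const : ∀ {k} (x : A) → form {k} (tabulate (λ _ → x)) ≡ constant x
  form-const {zero} x = refl
  form-const {suc zero} x with compare x x
  ... | tri< _ x≢x _ = ⊥-elim (x≢x refl)
  ... | tri≈ _ _ _   = refl
  ... | tri> _ x≢x _ = ⊥-elim (x≢x refl)
  form-const {suc (suc k)} x =
    trans (cong (λ m → formWithMajority m v) (majority-allBut {k} (λ _ → x) {x} zero (λ _ _ → refl)))
          (formWithMajority-constant v (lookup∘tabulate (λ _ → x)))
    where v = tabulate {n = 3 + k} (λ _ → x)

  form-single : ∀ {k} {x y : A} → x ≢ y → (i : Fin (3 + k)) →
                form (tabulate (oneOff x y i)) ≡ single x y i
  form-single {x = x} {y} x≢y i =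
    begin
      formWithMajority (majority (oneOff x y i zero) (oneOff x y i (suc zero)) (oneOff x y i (suc (suc zero)))) v
        ≡⟨ cong (λ m → formWithMajority m v) (majority-allBut (oneOff x y i) i (λ _ → oneOff-there x y i)) ⟩
      formWithMajority x v
        ≡⟨ formWithMajority-single v i
             (λ t t≢i → trans (lookup∘tabulate (oneOff x y i) t) (oneOff-there x y i t≢i))
                                 (λ vi≡x → x≢y (sym (trans (sym vi≡y) vi≡x))) ⟩
      single x (lookup v i) i
        ≡⟨ cong (λ z → single x z i) vi≡y ⟩
      single x y i
    ∎
    where
      open ≡-Reasoning
      v = tabulate (oneOff x y i)
      vi≡y : lookup v i ≡ y
      vi≡y = trans (lookup∘tabulate (oneOff x y i) i) (oneOff-here x y i)

  pairForm-swap : ∀ {x y : A} → x ≢ y → ∃₂ λ x′ y′ → ∃₂ λ j j′ →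
                  pairForm x y ≡ single x′ y′ j × pairForm y x ≡ single x′ y′ j′
  pairForm-swap {x} {y} x≢y with compare x y | compare y x
  ... | tri< _ _ _   | tri> _ _ _   = x , y , suc zero , zero , refl , refl
  ... | tri> _ _ _   | tri< _ _ _   = y , x , zero , suc zero , refl , refl
  ... | tri< _ _ y≮x | tri< y<x _ _ = ⊥-elim (y≮x y<x)
  ... | tri> y≮x _ _ | tri> _ _ y<x = ⊥-elim (y≮x y<x)
  ... | tri≈ _ x≡y _ | _            = ⊥-elim (x≢y x≡y)
  ... | _            | tri≈ _ y≡x _ = ⊥-elim (x≢y (sym y≡x))

  form-pair : ∀ {x y : A} → x ≢ y →
              ∃₂ λ x′ y′ → ∀ (i : Fin 2) → ∃ λ j → form (tabulate (oneOff x y i)) ≡ single x′ y′ j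
  form-pair x≢y with pairForm-swap x≢y
  ... | x′ , y′ , j , j′ , xy , yx = x′ , y′ , λ { zero → j′ , yx ; (suc zero) → j , xy }

  -- A tuple pointwise equal to f ∘ g that depends only on the values of g, and that is
  -- literally oneOff (f x) (f y) i when g is y at i and x elsewhere, x ≢ y, arity ≥ 3.
  module _ {B : Set} (b : Bool) (f : A → B) where

    present : ∀ {k} → (Fin (suc k) → A) → Fin (suc k) → B
    present g = ⟦ form (tabulate g) ⟧ b f

    present-≗ : ∀ {k} (g : Fin (suc k) → A) t → present g t ≡ f (g t)
    present-≗ g t = trans (form-sound b f (tabulate g) t) (cong f (lookup∘tabulate g t))

    present-cong : ∀ {k} {g h : Fin (suc k) → A} → g ≗ h → present g ≡ present h
    present-cong g≗h = cong (λ v → ⟦ form v ⟧ b f) (tabulate-cong g≗h)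

    present-const : ∀ {k} x → present {k} (λ _ → x) ≡ diagonal b (f x)
    present-const x = cong (λ F → ⟦ F ⟧ b f) (form-const x)

    present-diag : ∀ {k} x (i : Fin (suc k)) → present (oneOff x x i) ≡ diagonal b (f x)
    present-diag x i = trans (present-cong (oneOff-diag x i)) (present-const x)

    present-single : ∀ {k} {x y} → x ≢ y → (i : Fin (3 + k)) → present (oneOff x y i) ≡ oneOff (f x) (f y) i
    present-single x≢y i = cong (λ F → ⟦ F ⟧ b f) (form-single x≢y i)

    present-wnu-distinct : ∀ {k} (φ : (Fin (2 + k) → B) → B) → WNUIdentities φ →
                           ∀ {x y} → x ≢ y → ∀ i j → φ (present (oneOff x y i)) ≡ φ (present (oneOff x y j))
    present-wnu-distinct {suc k} φ weak x≢y i j =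
      trans (cong φ (present-single x≢y i)) (trans (weak _ _ i j) (cong φ (sym (present-single x≢y j))))
    present-wnu-distinct {zero} φ weak x≢y i j with form-pair x≢y
    ... | x′ , y′ , pair with pair i | pair j
    ...   | i′ , formᵢ | j′ , formⱼ =
      trans (cong (λ F → φ (⟦ F ⟧ b f)) formᵢ)
            (trans (weak _ _ i′ j′) (cong (λ F → φ (⟦ F ⟧ b f)) (sym formⱼ)))

    present-wnu : ∀ {k} (φ : (Fin (2 + k) → B) → B) → WNUIdentities φ → WNUIdentities (φ ∘ present)
    present-wnu φ weak x y i j with x ≟ y
    ... | yes refl = cong φ (trans (present-diag x i) (sym (present-diag x j)))
    ... | no x≢y   = present-wnu-distinct φ weak x≢y i j

    present-nu : (φ : (Fin 3 → B) → B) → DiagonalFixed b φ → NUIdentities φ →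
                 ∀ x y i → φ (present (oneOff x y i)) ≡ f x
    present-nu φ fixed nu x y i with x ≟ y
    ... | yes refl = trans (cong φ (present-diag x i)) (fixed (f x))
    ... | no x≢y   = trans (cong φ (present-single x≢y i)) (nu _ _ i)

module _ {B : Set} {k} (φ : (Fin (suc k) → B) → B) where

  diagonalFixed-nu : ∀ b → T b → (T b → NUIdentities φ) → DiagonalFixed b φ
  diagonalFixed-nu true t nu y = nu t y y zero

  diagonalFixed : ∀ b → (T b → NUIdentities φ) → Idempotent φ → DiagonalFixed b φ
  diagonalFixed true  nu _    = diagonalFixed-nu true tt nu
  diagonalFixed false _  idem = idem

-- Exactly what is needed to pull semi-conservativity back along retract.
record SwitchRetraction {A B : Set} (sA : A → A) (sB : B → B) : Set where
  field
    section         : A → B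
    retract         : B → A
    retract∘section : ∀ x → retract (section x) ≡ x
    retract-switch  : ∀ v → retract (sB v) ≡ sA (retract v)
    switch-lift     : ∀ v u → sA u ≡ retract v → ∃ λ w → retract w ≡ u × sB w ≡ v

idRetraction : ∀ {A : Set} (s : A → A) → SwitchRetraction s s
idRetraction s = record
  { section         = id
  ; retract         = id
  ; retract∘section = λ _ → refl
  ; retract-switch  = λ _ → refl
  ; switch-lift     = λ _ u su → u , refl , su
  }

module Restriction {A B : Set} {_<_ : Rel A 0ℓ} (compare : Trichotomous _≡_ _<_)
                   {sA : A → A} {sB : B → B} (ρ : SwitchRetraction sA sB) where
  open Presentation compare
  open SwitchRetraction ρ

  restrict : ∀ {k} → Bool → ((Fin (suc k) → B) → B) → (Fin (suc k) → A) → A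
  restrict b φ g = retract (φ (present b section g))

  module _ {k} (b : Bool) (φ : (Fin (suc k) → B) → B) where

    restrict-extensional : Extensional (restrict b φ)
    restrict-extensional g≗h = cong (retract ∘ φ) (present-cong b section g≗h)

    restrict-preserves : ∀ {RA : A → A → Set} {RB : B → B → Set} →
                         (∀ {x y} → RA x y → RB (section x) (section y)) →
                         (∀ {u v} → RB u v → RA (retract u) (retract v)) →
                         Preserves φ RB → Preserves (restrict b φ) RA
    restrict-preserves {RB = RB} section-rel retract-rel pres xs ys rel =
      retract-rel (pres _ _ λ i → subst₂ RB (sym (present-≗ b section xs i)) (sym (present-≗ b section ys i))
                                              (section-rel (rel i)))

    restrict-idempotent : DiagonalFixed b φ → Idempotent (restrict b φ)
    restrict-idempotent fixed x =
      trans (cong (retract ∘ φ) (present-const b section x))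
            (trans (cong retract (fixed (section x))) (retract∘section x))

    restrict-conservative : Conservative φ → Conservative (restrict b φ)
    restrict-conservative cons g with cons (present b section g)
    ... | i , φ≡ = i , trans (cong retract (trans φ≡ (present-≗ b section g i))) (retract∘section (g i))

    restrict-semiConservative : SemiConservative φ sB → SemiConservative (restrict b φ) sA
    restrict-semiConservative semi P (P-switch , P-unswitch) g Pg =
      semi (P ∘ retract) (closed-switch , closed-unswitch) (present b section g) P-present
      where
        closed-switch : ∀ v → P (retract v) → P (retract (sB v))
        closed-switch v Pv = subst P (sym (retract-switch v)) (P-switch (retract v) Pv)
        closed-unswitch : ∀ v → P (retract v) → ∃ λ w → P (retract w) × sB w ≡ v
        closed-unswitch v Pv with P-unswitch (retract v) Pv
        ... | u , Pu , su with switch-lift v u su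
        ...   | w , rw , sw = w , subst P (sym rw) Pu , sw
        P-present : ∀ i → P (retract (present b section g i))
        P-present i = subst (P ∘ retract) (sym (present-≗ b section g i))
                            (subst P (sym (retract∘section (g i))) (Pg i))

    restrict-nu : DiagonalFixed b φ → NU3 φ → NU3 (restrict b φ)
    restrict-nu fixed (refl , nu) = refl , λ x y i →
      trans (cong retract (present-nu b section φ fixed nu x y i)) (retract∘section x)

    restrict-wnu : DiagonalFixed b φ → WNU φ → WNU (restrict b φ)
    restrict-wnu fixed (2≤k , _ , weak) =
      2≤k , restrict-idempotent fixed , wnuIdentities 2≤k weak
      where
        wnuIdentities : 2 ≤ suc k → WNUIdentities φ → WNUIdentities (restrict b φ)
        wnuIdentities (s≤s (s≤s z≤n)) weak x y i j = cong retract (present-wnu b section φ weak x y i j)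

  restrict-satisfies : ∀ {k} {φ : (Fin (suc k) → B) → B} S → SatisfiesAll sB φ S →
                       SatisfiesAll sA (restrict (S nu3) φ) S
  restrict-satisfies {φ = φ} S sat = λ
    { idempotence t        → lift (restrict-idempotent b φ (fixed (lower (sat idempotence t))))
    ; conservativity t     → lift (restrict-conservative b φ (lower (sat conservativity t)))
    ; semiConservativity t → restrict-semiConservative b φ (sat semiConservativity t)
    ; nu3 t                → lift (restrict-nu b φ (fixed-nu t) (lower (sat nu3 t)))
    ; wnu t                → let w = lower (sat wnu t) in lift (restrict-wnu b φ (fixed (proj₁ (proj₂ w))) w)
    }
    where
      b = S nu3
      nu : T b → NUIdentities φ
      nu t = proj₂ (lower (sat nu3 t))
      fixed : Idempotent φ → DiagonalFixed b φ
      fixed = diagonalFixed φ b nu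
      fixed-nu : T b → DiagonalFixed b φ
      fixed-nu t = diagonalFixed-nu φ b t nu

module _ {X : Set} (s : X → X) where

  padUnary : ((Fin 1 → X) → X) → (Fin 3 → X) → X
  padUnary φ xs = φ (λ _ → xs zero)

  padUnary-extensional : ∀ φ → Extensional (padUnary φ)
  padUnary-extensional φ xs≗ys = cong (λ x → φ (λ _ → x)) (xs≗ys zero)

  padUnary-preserves : ∀ φ {R} → Preserves φ R → Preserves (padUnary φ) R
  padUnary-preserves φ pres xs ys rel = pres _ _ (λ _ → rel zero)

  padUnary-satisfies : ∀ {φ} S → SatisfiesAll s φ S → SatisfiesAll s (padUnary φ) S
  padUnary-satisfies S sat = λ
    { idempotence t        → sat idempotence t
    ; conservativity t     → lift λ xs → zero , proj₂ (lower (sat conservativity t) (λ _ → xs zero))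
    ; semiConservativity t → λ P closed xs Pxs →
        sat semiConservativity t P closed (λ _ → xs zero) (λ _ → Pxs zero)
    ; nu3 t                → ⊥-elim (1≢3 (proj₁ (lower (sat nu3 t))))
    ; wnu t                → ⊥-elim (2≰1 (proj₁ (lower (sat wnu t))))
    }
    where
      1≢3 : 1 ≢ 3
      1≢3 ()
      2≰1 : ¬ 2 ≤ 1
      2≰1 (s≤s ())

  module Quaternary (φ : (Fin 2 → X) → X) where

    ⟨_,_⟩ : X → X → Fin 2 → X
    ⟨ u , w ⟩ zero       = u
    ⟨ u , w ⟩ (suc zero) = w

    _∙_ : X → X → X
    u ∙ w = φ ⟨ u , w ⟩

    quaternary : (Fin 4 → X) → X
    quaternary xs = (xs zero ∙ xs (suc zero)) ∙ (xs (suc (suc zero)) ∙ xs (suc (suc (suc zero))))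

    quaternary-extensional : Extensional quaternary
    quaternary-extensional xs≗ys =
      cong₂ _∙_ (cong₂ _∙_ (xs≗ys _) (xs≗ys _)) (cong₂ _∙_ (xs≗ys _) (xs≗ys _))

    ∙-preserves : ∀ {R : X → X → Set} → Preserves φ R →
                  ∀ {u u′ w w′} → R u u′ → R w w′ → R (u ∙ w) (u′ ∙ w′)
    ∙-preserves pres ru rw = pres _ _ λ { zero → ru ; (suc zero) → rw }

    quaternary-preserves : ∀ {R} → Preserves φ R → Preserves quaternary R
    quaternary-preserves {R} pres xs ys rel =
      ∙-preserves {R} pres (∙-preserves {R} pres (rel zero) (rel (suc zero)))
                           (∙-preserves {R} pres (rel (suc (suc zero))) (rel (suc (suc (suc zero)))))

    module _ (ext : Extensional φ) where

      ∙-idem : Idempotent φ → ∀ u → u ∙ u ≡ u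
      ∙-idem idem u = trans (ext λ { zero → refl ; (suc zero) → refl }) (idem u)

      ∙-comm : WNUIdentities φ → ∀ u w → u ∙ w ≡ w ∙ u
      ∙-comm weak u w = begin
        φ ⟨ u , w ⟩          ≡⟨ ext (λ { zero → refl ; (suc zero) → refl }) ⟩
        φ (oneOff u w (suc zero)) ≡⟨ weak u w (suc zero) zero ⟩
        φ (oneOff u w zero)  ≡⟨ ext (λ { zero → refl ; (suc zero) → refl }) ⟩
        φ ⟨ w , u ⟩          ∎
        where open ≡-Reasoning

      quaternary-idempotent : Idempotent φ → Idempotent quaternary
      quaternary-idempotent idem x = trans (cong₂ _∙_ (∙-idem idem x) (∙-idem idem x)) (∙-idem idem x)

      quaternary-oneOff : Idempotent φ → WNUIdentities φ → ∀ a c i → quaternary (oneOff a c i) ≡ (a ∙ c) ∙ a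
      quaternary-oneOff idem weak a c zero = cong₂ _∙_ (∙-comm weak c a) (∙-idem idem a)
      quaternary-oneOff idem weak a c (suc zero) = cong ((a ∙ c) ∙_) (∙-idem idem a)
      quaternary-oneOff idem weak a c (suc (suc zero)) =
        trans (cong₂ _∙_ (∙-idem idem a) (∙-comm weak c a)) (∙-comm weak a (a ∙ c))
      quaternary-oneOff idem weak a c (suc (suc (suc zero))) =
        trans (cong (_∙ (a ∙ c)) (∙-idem idem a)) (∙-comm weak a (a ∙ c))

      ∙-conservative : Conservative φ → ∀ u w → u ∙ w ≡ u ⊎ u ∙ w ≡ w
      ∙-conservative cons u w with cons ⟨ u , w ⟩
      ... | zero , e     = inj₁ e
      ... | suc zero , e = inj₂ e

      quaternary-conservative : Conservative φ → Conservative quaternary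
      quaternary-conservative cons xs
        with ∙-conservative cons (xs zero ∙ xs (suc zero)) (xs (suc (suc zero)) ∙ xs (suc (suc (suc zero))))
      ... | inj₁ e with ∙-conservative cons (xs zero) (xs (suc zero))
      ...   | inj₁ e′ = zero , trans e e′
      ...   | inj₂ e′ = suc zero , trans e e′
      quaternary-conservative cons xs | inj₂ e with ∙-conservative cons (xs (suc (suc zero))) (xs (suc (suc (suc zero))))
      ...   | inj₁ e′ = suc (suc zero) , trans e e′
      ...   | inj₂ e′ = suc (suc (suc zero)) , trans e e′

      quaternary-semiConservative : SemiConservative φ s → SemiConservative quaternary s
      quaternary-semiConservative semi P closed xs Pxs = ∙-closed (∙-closed (Pxs _) (Pxs _)) (∙-closed (Pxs _) (Pxs _))
        where
          ∙-closed : ∀ {u w} → P u → P w → P (u ∙ w)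
          ∙-closed Pu Pw = semi P closed ⟨ _ , _ ⟩ λ { zero → Pu ; (suc zero) → Pw }

      quaternary-wnu : WNU φ → WNU quaternary
      quaternary-wnu (_ , idem , weak) =
        s≤s (s≤s z≤n) , quaternary-idempotent idem ,
        λ a c i j → trans (quaternary-oneOff idem weak a c i) (sym (quaternary-oneOff idem weak a c j))

      quaternary-satisfies : ∀ S → SatisfiesAll s φ S → SatisfiesAll s quaternary S
      quaternary-satisfies S sat = λ
        { idempotence t        → lift (quaternary-idempotent (lower (sat idempotence t)))
        ; conservativity t     → lift (quaternary-conservative (lower (sat conservativity t)))
        ; semiConservativity t → quaternary-semiConservative (sat semiConservativity t)
        ; nu3 t                → ⊥-elim (2≢3 (proj₁ (lower (sat nu3 t))))
        ; wnu t                → lift (quaternary-wnu (lower (sat wnu t)))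
        }
        where
          2≢3 : 2 ≢ 3
          2≢3 ()

Uniform : ∀ {k} → (Fin (suc k) → Bool) → Set
Uniform c = ∀ t → c t ≡ c zero

uniform? : ∀ {k} (c : Fin (suc k) → Bool) → Dec (Uniform c)
uniform? c = all? (λ t → c t ≟ᵇ c zero)

uniform-flip : ∀ {k} {c d : Fin (suc k) → Bool} → d ≗ not ∘ c → Uniform c → Uniform d
uniform-flip d≗¬c uc t = trans (d≗¬c t) (trans (cong not (uc t)) (sym (d≗¬c zero)))

flip-sym : ∀ {k} {c d : Fin k → Bool} → d ≗ not ∘ c → c ≗ not ∘ d
flip-sym d≗¬c t = trans (sym (not-involutive _)) (cong not (sym (d≗¬c t)))

xor-flip : ∀ a b → T (a xor b) → b ≡ not a
xor-flip false true  _ = refl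
xor-flip true  false _ = refl

-- The index of a parity that occurs at least twice among the first three coordinates.
majorityIndex : ∀ {m} → (Fin (3 + m) → Bool) → Fin (3 + m)
majorityIndex c = if (c zero xor c (suc zero)) ∧ (c zero xor c (suc (suc zero))) then suc zero else zero

majorityIndex-cong : ∀ {m} {c d : Fin (3 + m) → Bool} → c ≗ d → majorityIndex c ≡ majorityIndex d
majorityIndex-cong c≗d =
  cong (λ z → if z then suc zero else zero)
       (cong₂ _∧_ (cong₂ _xor_ (c≗d _) (c≗d _)) (cong₂ _xor_ (c≗d _) (c≗d _)))

not-xor-not : ∀ a b → not a xor not b ≡ a xor b
not-xor-not false b = not-involutive b
not-xor-not true  b = refl

majorityIndex-not : ∀ {m} (c : Fin (3 + m) → Bool) → majorityIndex (not ∘ c) ≡ majorityIndex c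
majorityIndex-not c =
  cong (λ z → if z then suc zero else zero)
       (cong₂ _∧_ (not-xor-not (c zero) _) (not-xor-not (c zero) _))

majorityIndex-flip : ∀ {m} {c d : Fin (3 + m) → Bool} → d ≗ not ∘ c → majorityIndex d ≡ majorityIndex c
majorityIndex-flip {c = c} d≗¬c = trans (majorityIndex-cong d≗¬c) (majorityIndex-not c)

majorityIndex-oneOff : ∀ {m} a (i : Fin (3 + m)) → majorityIndex (oneOff a (not a) i) ≢ i
majorityIndex-oneOff false zero ()
majorityIndex-oneOff true  zero ()
majorityIndex-oneOff false (suc zero) ()
majorityIndex-oneOff true  (suc zero) ()
majorityIndex-oneOff false (suc (suc zero)) ()
majorityIndex-oneOff true  (suc (suc zero)) ()
majorityIndex-oneOff false (suc (suc (suc i))) ()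
majorityIndex-oneOff true  (suc (suc (suc i))) ()

≡-compare : ∀ {A B : Set} {_<_ : Rel (A × B) 0ℓ} →
            Trichotomous (Pointwise _≡_ _≡_) _<_ → Trichotomous _≡_ _<_
≡-compare cmp x y with cmp x y
... | tri< x<y x≉y x≯y = tri< x<y (x≉y ∘ ≡⇒≡×≡) x≯y
... | tri≈ x≮y x≈y x≯y = tri≈ x≮y (≡×≡⇒≡ x≈y) x≯y
... | tri> x≮y x≉y x>y = tri> x≮y (x≉y ∘ ≡⇒≡×≡) x>y

module _ (H : BrGraph) where

  comparePVert : Trichotomous _≡_ (×-Lex _≡_ (Fin._<_ {BrGraph.n H}) Bool._<_)
  comparePVert = ≡-compare (×-compare sym <ᶠ-cmp <ᵇ-cmp)

  vertex : QVert H → PVert H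
  vertex q = proj₁ q , proj₁ (proj₂ q)

  parityOf : QVert H → Bool
  parityOf q = proj₂ (proj₂ q)

  _at_ : PVert H → Bool → QVert H
  u at c = proj₁ u , proj₂ u , c

  QRel : (PVert H → PVert H → Set) → QVert H → QVert H → Set
  QRel R x y = R (vertex x) (vertex y) × T (parityOf x xor parityOf y)

  forgetParity : SwitchRetraction (switch H) (switchQ H)
  forgetParity = record
    { section         = _at false
    ; retract         = vertex
    ; retract∘section = λ _ → refl
    ; retract-switch  = λ _ → refl
    ; switch-lift     = λ v u su → u at parityOf v , refl , cong (_at parityOf v) su
    }

  open Presentation comparePVert using (present; present-≗)
  module ForgetParity = Restriction comparePVert forgetParity

  -- x at false and y at false are not adjacent, but x at false and parity (y at false) are;
  -- parity symmetry of ψ then removes the parity again.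
  paritySymmetric-restrict-preserves : ∀ {k} b {ψ : (Fin (suc k) → QVert H) → QVert H} →
                                       ParitySymmetric H ψ → ∀ {R} → Preserves ψ (QRel R) →
                                       Preserves (ForgetParity.restrict b ψ) R
  paritySymmetric-restrict-preserves b {ψ} symm {R} pres xs ys rel =
    proj₁ (subst (QRel R (ψ (present b (_at false) xs))) (symm (present b (_at false) ys))
                 (pres _ _ λ i → subst₂ (λ x y → QRel R x (parity H y))
                                        (sym (present-≗ b (_at false) xs i)) (sym (present-≗ b (_at false) ys i))
                                        (rel i , tt)))

  fromParitySymmetric : ∀ S → HasParitySymPolyPHxP H S → HasPolyPH H S
  fromParitySymmetric S (k , ψ , (red , blue) , symm , sat) =
    k , ForgetParity.restrict b ψ ,
    (paritySymmetric-restrict-preserves b symm {PRed H} red ,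
     paritySymmetric-restrict-preserves b symm {PBlue H} blue) ,
    ForgetParity.restrict-satisfies S sat
    where b = S nu3

  module _ {m : ℕ} (φ : (Fin (3 + m) → PVert H) → PVert H) where

    parityLift : (Fin (3 + m) → QVert H) → QVert H
    parityLift xs with uniform? (parityOf ∘ xs)
    ... | yes _ = φ (vertex ∘ xs) at parityOf (xs zero)
    ... | no _  = xs (majorityIndex (parityOf ∘ xs))

    parityLift-uniform : ∀ xs → Uniform (parityOf ∘ xs) → parityLift xs ≡ φ (vertex ∘ xs) at parityOf (xs zero)
    parityLift-uniform xs u with uniform? (parityOf ∘ xs)
    ... | yes _ = refl
    ... | no ¬u = ⊥-elim (¬u u)

    parityLift-mixed : ∀ xs → ¬ Uniform (parityOf ∘ xs) → parityLift xs ≡ xs (majorityIndex (parityOf ∘ xs))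
    parityLift-mixed xs ¬u with uniform? (parityOf ∘ xs)
    ... | yes u = ⊥-elim (¬u u)
    ... | no _  = refl

    parityLift-paritySymmetric : ParitySymmetric H parityLift
    parityLift-paritySymmetric xs with uniform? (parityOf ∘ xs)
    ... | yes u = parityLift-uniform (parity H ∘ xs) (uniform-flip (λ _ → refl) u)
    ... | no ¬u = trans (parityLift-mixed (parity H ∘ xs)
                                          (¬u ∘ uniform-flip (flip-sym {c = parityOf ∘ xs} λ _ → refl)))
                        (cong (parity H ∘ xs) (majorityIndex-not (parityOf ∘ xs)))

    parityLift-preserves : ∀ {R} → Preserves φ R → Preserves parityLift (QRel R)
    parityLift-preserves {R} pres xs ys rel with uniform? (parityOf ∘ xs)
    ... | yes u = subst (QRel R (φ (vertex ∘ xs) at parityOf (xs zero)))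
                        (sym (parityLift-uniform ys (uniform-flip flipped u)))
                        (pres _ _ (proj₁ ∘ rel) , proj₂ (rel zero))
      where
        flipped : parityOf ∘ ys ≗ not ∘ parityOf ∘ xs
        flipped i = xor-flip _ _ (proj₂ (rel i))
    ... | no ¬u = subst (QRel R (xs r))
                        (sym (trans (parityLift-mixed ys (¬u ∘ uniform-flip (flip-sym flipped)))
                                    (cong ys (majorityIndex-flip flipped))))
                        (rel r)
      where
        flipped : parityOf ∘ ys ≗ not ∘ parityOf ∘ xs
        flipped i = xor-flip _ _ (proj₂ (rel i))
        r = majorityIndex (parityOf ∘ xs)

    parityLift-idempotent : Idempotent φ → Idempotent parityLift
    parityLift-idempotent idem X =
      trans (parityLift-uniform (λ _ → X) (λ _ → refl)) (cong (_at parityOf X) (idem (vertex X)))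

    parityLift-conservative : Conservative φ → Conservative parityLift
    parityLift-conservative cons xs with uniform? (parityOf ∘ xs)
    ... | no _  = majorityIndex (parityOf ∘ xs) , refl
    ... | yes u with cons (vertex ∘ xs)
    ...   | i , φ≡ = i , trans (cong (_at parityOf (xs zero)) φ≡) (cong (vertex (xs i) at_) (sym (u i)))

    parityLift-semiConservative : SemiConservative φ (switch H) → SemiConservative parityLift (switchQ H)
    parityLift-semiConservative semi P (P-switch , P-unswitch) xs Pxs with uniform? (parityOf ∘ xs)
    ... | no _  = Pxs _
    ... | yes u = semi (P ∘ (_at c)) (closed-switch , closed-unswitch) (vertex ∘ xs)
                       (λ i → subst (λ d → P (vertex (xs i) at d)) (u i) (Pxs i))
      where
        c = parityOf (xs zero)
        closed-switch : ∀ v → P (v at c) → P (switch H v at c)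
        closed-switch v = P-switch (v at c)
        closed-unswitch : ∀ v → P (v at c) → ∃ λ w → P (w at c) × switch H w ≡ v
        closed-unswitch v Pv with P-unswitch (v at c) Pv
        ... | w , Pw , sw = vertex w , subst (λ d → P (vertex w at d)) (cong parityOf sw) Pw , cong vertex sw

    parityLift-oneOff-uniform : Extensional φ → ∀ X Y i → parityOf X ≡ parityOf Y →
                                parityLift (oneOff X Y i) ≡ φ (oneOff (vertex X) (vertex Y) i) at parityOf X
    parityLift-oneOff-uniform ext X Y i same =
      trans (parityLift-uniform (oneOff X Y i) (λ t → trans (parity≡ t) (sym (parity≡ zero))))
            (cong₂ _at_ (ext (oneOff-map vertex X Y i)) (parity≡ zero))
      where
        parity≡ : ∀ t → parityOf (oneOff X Y i t) ≡ parityOf X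
        parity≡ t = trans (oneOff-map parityOf X Y i t)
                          (trans (cong (λ d → oneOff (parityOf X) d i t) (sym same)) (oneOff-diag _ i t))

    parityLift-oneOff-mixed : ∀ X Y i → parityOf X ≢ parityOf Y → parityLift (oneOff X Y i) ≡ X
    parityLift-oneOff-mixed X Y i differ =
      trans (parityLift-mixed (oneOff X Y i) mixed) (oneOff-there X Y i r≢i)
      where
        c = parityOf ∘ oneOff X Y i
        c≗ : c ≗ oneOff (parityOf X) (not (parityOf X)) i
        c≗ t = trans (oneOff-map parityOf X Y i t) (cong (λ d → oneOff (parityOf X) d i t) (¬-not (differ ∘ sym)))
        r≢i : majorityIndex c ≢ i
        r≢i = majorityIndex-oneOff (parityOf X) i ∘ trans (sym (majorityIndex-cong c≗))
        mixed : ¬ Uniform c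
        mixed u = differ (begin
          parityOf X                  ≡⟨ sym (cong parityOf (oneOff-there X Y i r≢i)) ⟩
          c (majorityIndex c)         ≡⟨ u _ ⟩
          c zero                      ≡⟨ sym (u i) ⟩
          c i                         ≡⟨ cong parityOf (oneOff-here X Y i) ⟩
          parityOf Y                  ∎)
          where open ≡-Reasoning

    parityLift-nu : Extensional φ → NU3 φ → NU3 parityLift
    parityLift-nu ext (refl , nu) = refl , λ X Y i → case-parity X Y i
      where
        case-parity : ∀ X Y i → parityLift (oneOff X Y i) ≡ X
        case-parity X Y i with parityOf X ≟ᵇ parityOf Y
        ... | yes same  = trans (parityLift-oneOff-uniform ext X Y i same) (cong (_at parityOf X) (nu _ _ i))
        ... | no differ = parityLift-oneOff-mixed X Y i differ

    parityLift-wnu : Extensional φ → WNU φ → WNU parityLift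
    parityLift-wnu ext (2≤ , idem , weak) = 2≤ , parityLift-idempotent idem , weak-lift
      where
        weak-lift : WNUIdentities parityLift
        weak-lift X Y i j with parityOf X ≟ᵇ parityOf Y
        ... | yes same  = trans (parityLift-oneOff-uniform ext X Y i same)
                                (trans (cong (_at parityOf X) (weak _ _ i j))
                                       (sym (parityLift-oneOff-uniform ext X Y j same)))
        ... | no differ = trans (parityLift-oneOff-mixed X Y i differ) (sym (parityLift-oneOff-mixed X Y j differ))

    parityLift-satisfies : Extensional φ → ∀ S → SatisfiesAll (switch H) φ S →
                           SatisfiesAll (switchQ H) parityLift S
    parityLift-satisfies ext S sat = λ
      { idempotence t        → lift (parityLift-idempotent (lower (sat idempotence t)))
      ; conservativity t     → lift (parityLift-conservative (lower (sat conservativity t)))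
      ; semiConservativity t → parityLift-semiConservative (sat semiConservativity t)
      ; nu3 t                → lift (parityLift-nu ext (lower (sat nu3 t)))
      ; wnu t                → lift (parityLift-wnu ext (lower (sat wnu t)))
      }

  ExtensionalPolymorphism : PropertySet → ℕ → Set₁
  ExtensionalPolymorphism S k = Σ ((Fin k → PVert H) → PVert H) λ φ →
    Extensional φ × IsPolymorphism (switchingGraph H) k φ × SatisfiesAll (switch H) φ S

  module SelfRestriction = Restriction comparePVert (idRetraction (switch H))

  extensionalize : ∀ S → HasPolyPH H S → ∃ λ k → ExtensionalPolymorphism S (suc k)
  extensionalize S (k , φ , (red , blue) , sat) =
    k , restrict b φ , restrict-extensional b φ ,
    (restrict-preserves b φ {PRed H} id id red , restrict-preserves b φ {PBlue H} id id blue) ,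
    restrict-satisfies S sat
    where
      open SelfRestriction
      b = S nu3

  arity≥3 : ∀ S k → ExtensionalPolymorphism S (suc k) → ∃ λ m → ExtensionalPolymorphism S (3 + m)
  arity≥3 S zero (φ , _ , (red , blue) , sat) =
    0 , padUnary (switch H) φ , padUnary-extensional (switch H) φ ,
    (padUnary-preserves (switch H) φ {PRed H} red , padUnary-preserves (switch H) φ {PBlue H} blue) ,
    padUnary-satisfies (switch H) S sat
  arity≥3 S (suc zero) (φ , ext , (red , blue) , sat) =
    1 , quaternary , quaternary-extensional ,
    (quaternary-preserves {PRed H} red , quaternary-preserves {PBlue H} blue) , quaternary-satisfies ext S sat
    where open Quaternary (switch H) φ
  arity≥3 S (suc (suc m)) E = m , E

  paritySymmetricLift : ∀ S {m} → ExtensionalPolymorphism S (3 + m) → HasParitySymPolyPHxP H S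
  paritySymmetricLift S {m} (φ , ext , (red , blue) , sat) =
    2 + m , parityLift φ , (parityLift-preserves φ {PRed H} red , parityLift-preserves φ {PBlue H} blue) ,
    parityLift-paritySymmetric φ , parityLift-satisfies φ ext S sat

  toParitySymmetric : ∀ S → HasPolyPH H S → HasParitySymPolyPHxP H S
  toParitySymmetric S P with extensionalize S P
  ... | k , E = paritySymmetricLift S (proj₂ (arity≥3 S k E))

proposition5p4 : (H : BrGraph) (S : PropertySet) → HasPolyPH H S ⇔ HasParitySymPolyPHxP H S
proposition5p4 H S = mk⇔ (toParitySymmetric H S) (fromParitySymmetric H S)
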